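{- For arbitrary pointed simplicial models $(\mathcal C,X)$ and $(\mathcal C',X')$, \[ (\mathcal C,X)\mathrel{\underline{\leftrightarrow}}(\mathcal C',X') \quad\Longrightarrow\quad (\mathcal C,X)\equiv_{\mathcal L^+}(\mathcal C',X'). \]
   Context: Let $A$ be a finite set of agents and, for each $a\in A$, $P_a$ a countable set of local atoms (mutually disjoint). The language $\mathcal L^+$ is $\varphi ::= a \mid p_a \mid \neg\varphi \mid (\varphi\wedge\varphi)\mid \widehat K_a\varphi$ with $a\in A$ (global atom "agent $a$ is alive") and $p_a\in P_a$. A simplicial model $\mathcal C=(C,\chi,\ell)$ consists of a nonempty downward-closed set $C$ of nonempty finite subsets (simplexes) of a vertex set containing all singletons, a chromatic map $\chi$ from vertices to agents injective on each simplex, and a valuation $\ell$ assigning to each vertex $v$ a subset of $P_{\chi(v)}$; $\chi(X)$ and $\ell(X)$ are the unions over vertices of $X$; $\mathcal F(C)$ is the set of facets (maximal simplexes); a pointed model is $(\mathcal C,X)$ with $X\in\mathcal F(C)$. Three-valued semantics on facets: definability $\bowtie$: $a$ always defined; $p_a$ defined iff $a\in\chi(X)$; $\neg\varphi$ defined iff $\varphi$ is; $\varphi\wedge\psi$ defined iff both are; $\widehat K_a\varphi$ defined iff $\varphi$ is defined in some facet $Y$ with $a\in\chi(X\cap Y)$. Truth $\vDash$: $a$ true iff $a\in\chi(X)$; $p_a$ true iff $p_a\in\ell(X)$; $\neg\varphi$ true iff $\varphi$ defined and not true; $\varphi\wedge\psi$ true iff both true; $\widehat K_a\varphi$ true iff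 $\varphi$ true in some facet $Y$ with $a\in\chi(X\cap Y)$. $(\mathcal C,X)\equiv_{\mathcal L^+}(\mathcal C',X')$ means that for every $\varphi\in\mathcal L^+$, $\varphi$ is defined/true/has true negation in $(\mathcal C,X)$ iff the same holds in $(\mathcal C',X')$. A bisimulation between $\mathcal C$ and $\mathcal C'$ is a nonempty relation $\mathcal B\subseteq\mathcal F(C)\times\mathcal F(C')$ such that whenever $X\mathcal B X'$: (atoms) $\chi(X)=\chi'(X')$ and $\ell(X)=\ell'(X')$; (forth) for each $a$ and each facet $Y$ with $a\in\chi(X\cap Y)$ there is a facet $Y'$ with $a\in\chi'(X'\cap Y')$ and $Y\mathcal B Y'$; (back) symmetrically. $(\mathcal C,X)\mathrel{\underline{\leftrightarrow}}(\mathcal C',X')$ means there is a bisimulation relating $X$ and $X'$. -}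

module Defs where

open import Level using (Level; 0ℓ; Lift) renaming (suc to lsuc)
open import Data.Unit using (⊤)
open import Data.Nat using (ℕ)
open import Data.Fin using (Fin)
open import Data.List using (List)
open import Data.List.Membership.Propositional using (_∈_)
open import Data.Product using (Σ; ∃; _×_; _,_; proj₁)
open import Relation.Binary.PropositionalEquality using (_≡_)
open import Relation.Nullary using (¬_)
open import Function.Bundles using (_⇔_)

-- Agents: A = Fin n (an arbitrary finite set).
-- Local atoms of agent a: P_a = {a} × ℕ (countable, pairwise disjoint).

Subset : Set → Set₁
Subset V = V → Set

_⊆_ : {V : Set} → Subset V → Subset V → Set
X ⊆ Y = ∀ v → X v → Y v

NonEmpty : {V : Set} → Subset V → Set
NonEmpty {V} X = Σ V X

Finite : {V : Set} → Subset V → Set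
Finite {V} X = Σ (List V) λ xs → ∀ v → X v → v ∈ xs

⟦_⟧ : {V : Set} → V → Subset V
⟦ v ⟧ = λ w → w ≡ v

_∩_ : {V : Set} → Subset V → Subset V → Subset V
(X ∩ Y) v = X v × Y v

record SimplicialModel (n : ℕ) : Set₁ where
  field
    V      : Set
    C      : Subset V → Set
    χ      : V → Fin n
    ℓ      : V → ℕ → Set                -- ℓ v k : atom (χ v , k) ∈ ℓ(v)
    C-nonempty   : Σ (Subset V) C
    simplex-nonempty : ∀ X → C X → NonEmpty X
    simplex-finite   : ∀ X → C X → Finite X
    down-closed  : ∀ X Y → C X → NonEmpty Y → Y ⊆ X → C Y
    singletons   : ∀ v → C ⟦ v ⟧
    χ-injective  : ∀ X → C X → ∀ v w → X v → X w → χ v ≡ χ w → v ≡ w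

module _ {n : ℕ} (M : SimplicialModel n) where
  open SimplicialModel M

  InColors : Fin n → Subset V → Set
  InColors a X = Σ V λ v → X v × χ v ≡ a

  InVal : Fin n → ℕ → Subset V → Set
  InVal a k X = Σ V λ v → X v × χ v ≡ a × ℓ v k

  IsFacet : Subset V → Set₁
  IsFacet X = C X × (∀ Y → C Y → X ⊆ Y → Y ⊆ X)

  Facet : Set₁
  Facet = Σ (Subset V) IsFacet

data Form (n : ℕ) : Set where
  alive : Fin n → Form n                 -- global atom a
  atom  : Fin n → ℕ → Form n
  ¬'_   : Form n → Form n
  _∧'_  : Form n → Form n → Form n
  K̂     : Fin n → Form n → Form n

module _ {n : ℕ} (M : SimplicialModel n) where
  open SimplicialModel M

  Defined : Facet M → Form n → Set₁
  Defined X (alive a)   = Lift (lsuc 0ℓ) ⊤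
  Defined X (atom a k)  = Lift (lsuc 0ℓ) (InColors M a (proj₁ X))
  Defined X (¬' φ)      = Defined X φ
  Defined X (φ ∧' ψ)    = Defined X φ × Defined X ψ
  Defined X (K̂ a φ)     = Σ (Facet M) λ Y → InColors M a (proj₁ X ∩ proj₁ Y) × Defined Y φ

  True : Facet M → Form n → Set₁
  True X (alive a)   = Lift (lsuc 0ℓ) (InColors M a (proj₁ X))
  True X (atom a k)  = Lift (lsuc 0ℓ) (InVal M a k (proj₁ X))
  True X (¬' φ)      = Defined X φ × ¬ True X φ
  True X (φ ∧' ψ)    = True X φ × True X ψ
  True X (K̂ a φ)     = Σ (Facet M) λ Y → InColors M a (proj₁ X ∩ proj₁ Y) × True Y φ

ModEquiv : {n : ℕ} (M M' : SimplicialModel n) → Facet M → Facet M' → Set₁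
ModEquiv {n} M M' X X' = ∀ (φ : Form n) →
    (Defined M X φ ⇔ Defined M' X' φ)
  × (True M X φ ⇔ True M' X' φ)
  × (True M X (¬' φ) ⇔ True M' X' (¬' φ))

record IsBisimulation {n : ℕ} (M M' : SimplicialModel n)
                      (B : Facet M → Facet M' → Set₁) : Set₂ where
  field
    nonempty : Σ (Facet M) λ X → Σ (Facet M') λ X' → B X X'
    atoms-χ  : ∀ X X' → B X X' → ∀ a →
               InColors M a (proj₁ X) ⇔ InColors M' a (proj₁ X')
    atoms-ℓ  : ∀ X X' → B X X' → ∀ a k →
               InVal M a k (proj₁ X) ⇔ InVal M' a k (proj₁ X')
    forth    : ∀ X X' → B X X' → ∀ a (Y : Facet M) → InColors M a (proj₁ X ∩ proj₁ Y) →
               Σ (Facet M') λ Y' → InColors M' a (proj₁ X' ∩ proj₁ Y') × B Y Y'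
    back     : ∀ X X' → B X X' → ∀ a (Y' : Facet M') → InColors M' a (proj₁ X' ∩ proj₁ Y') →
               Σ (Facet M) λ Y → InColors M a (proj₁ X ∩ proj₁ Y) × B Y Y'

Bisimilar : {n : ℕ} (M M' : SimplicialModel n) → Facet M → Facet M' → Set₂
Bisimilar M M' X X' =
  Σ (Facet M → Facet M' → Set₁) λ B → IsBisimulation M M' B × B X X'

{-# OPTIONS --safe #-}
module Submission where

open import Defs
open import Data.Nat using (ℕ)
open import Data.Product using (_,_)
open import Function.Base using (flip)
open import Function.Bundles using (_⇔_; mk⇔; module Equivalence)
open import Function.Properties.Equivalence using (sym)
open import Level using (lift)

-- Truth of a negation also requires
-- the negated formula to be false, so its transport needs the reverse direction;
-- that is the same argument applied to the converse bisimulation.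

open Equivalence using (to)

isBisimulation-converse : ∀ {n} {M M' : SimplicialModel n} {B : Facet M → Facet M' → Set₁} →
  IsBisimulation M M' B → IsBisimulation M' M (flip B)
isBisimulation-converse isB = record
  { nonempty = let X , X' , b = nonempty in X' , X , b
  ; atoms-χ  = λ X' X b a → sym (atoms-χ X X' b a)
  ; atoms-ℓ  = λ X' X b a k → sym (atoms-ℓ X X' b a k)
  ; forth    = λ X' X b → back X X' b
  ; back     = λ X' X b → forth X X' b
  }
  where open IsBisimulation isB

module _ {n : ℕ} where

  Defined-transport :
    ∀ {M M' : SimplicialModel n} {B : Facet M → Facet M' → Set₁} → IsBisimulation M M' B →
    ∀ φ {X X'} → B X X' → Defined M X φ → Defined M' X' φ
  Defined-transport isB (alive a) b d = d
  Defined-transport isB (atom a k) {X} {X'} b (lift d) =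
    lift (to (IsBisimulation.atoms-χ isB X X' b a) d)
  Defined-transport isB (¬' φ) b d = Defined-transport isB φ b d
  Defined-transport isB (φ ∧' ψ) b (d , e) =
    Defined-transport isB φ b d , Defined-transport isB ψ b e
  Defined-transport isB (K̂ a φ) {X} {X'} b (Y , c , d) =
    let Y' , c' , b' = IsBisimulation.forth isB X X' b a Y c
    in Y' , c' , Defined-transport isB φ b' d

  True-transport :
    ∀ {M M' : SimplicialModel n} {B : Facet M → Facet M' → Set₁} → IsBisimulation M M' B →
    ∀ φ {X X'} → B X X' → True M X φ → True M' X' φ
  True-transport isB (alive a) {X} {X'} b (lift t) =
    lift (to (IsBisimulation.atoms-χ isB X X' b a) t)
  True-transport isB (atom a k) {X} {X'} b (lift t) =
    lift (to (IsBisimulation.atoms-ℓ isB X X' b a k) t)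
  True-transport isB (¬' φ) b (d , ¬t) =
    Defined-transport isB φ b d , λ t' → ¬t (True-transport (isBisimulation-converse isB) φ b t')
  True-transport isB (φ ∧' ψ) b (t , u) =
    True-transport isB φ b t , True-transport isB ψ b u
  True-transport isB (K̂ a φ) {X} {X'} b (Y , c , t) =
    let Y' , c' , b' = IsBisimulation.forth isB X X' b a Y c
    in Y' , c' , True-transport isB φ b' t

  module _ {M M' : SimplicialModel n} {B : Facet M → Facet M' → Set₁}
           (isB : IsBisimulation M M' B) {X : Facet M} {X' : Facet M'} (b : B X X') where

    Defined-invariant : ∀ φ → Defined M X φ ⇔ Defined M' X' φ
    Defined-invariant φ =
      mk⇔ (Defined-transport isB φ b) (Defined-transport (isBisimulation-converse isB) φ b)

    True-invariant : ∀ φ → True M X φ ⇔ True M' X' φ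
    True-invariant φ =
      mk⇔ (True-transport isB φ b) (True-transport (isBisimulation-converse isB) φ b)

theorem4p2 : ∀ {n : ℕ} (M M' : SimplicialModel n) (X : Facet M) (X' : Facet M') →
    Bisimilar M M' X X' → ModEquiv M M' X X'
theorem4p2 M M' X X' (B , isB , b) φ =
  Defined-invariant isB b φ , True-invariant isB b φ , True-invariant isB b (¬' φ)
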